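{- Let $\mathcal L$ be $\mathcal H_{\mathbf\Sigma}(@)$ or $\mathcal H_{\mathbf\Sigma}(@,\forall)$, let $\mathbf\Gamma=\{\Gamma_t\}_{t\in S}$ be an $S$-sorted set of formulas ($\Gamma_t$ of sort $t$), and let $\phi$ be a formula of sort $s\in S$. Suppose there are sorts $s_1,\dots,s_n\in S$, nominals $j_1\in\mathrm{NOM}_{s_1},\dots,j_n\in\mathrm{NOM}_{s_n}$ and formulas $\gamma_1\in\Gamma_{s_1},\dots,\gamma_n\in\Gamma_{s_n}$ such that $\vdash_s@^s_{j_1}\gamma_1\wedge\dots\wedge@^s_{j_n}\gamma_n\to\phi$ in $\mathcal L$. Then every model $\mathcal M$ such that each $\gamma\in\Gamma_t$ is valid in $\mathcal M$ (for all $t\in S$) also satisfies that $\phi$ is valid in $\mathcal M$.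
   Context: Signature $\mathbf\Sigma=(S,\Sigma,N)$: sorts $S$, operation symbols $\Sigma$ ($\Sigma_{s_1\cdots s_n,s}$ of arity $s_1\cdots s_n\to s$), $S$-sorted constant nominals $N$; countable $S$-sorted sets $\mathrm{PROP}$, $\mathrm{NOM}$ (nominals), $\mathrm{SVAR}$ (state variables). Formulas of sort $s$: $\phi_s::=p\mid j\mid y\mid\neg\phi_s\mid\phi_s\vee\phi_s\mid\sigma(\phi_{s_1},\dots,\phi_{s_n})\mid@^s_k\phi_t\mid\forall x\,\phi_s$ ($p\in\mathrm{PROP}_s$, $j\in\mathrm{NOM}_s\cup N_s$, $y\in\mathrm{SVAR}_s$, $k\in\mathrm{NOM}_t\cup N_t$, $\phi_t$ of sort $t$, $x\in\mathrm{SVAR}_t$ any $t$); $\mathcal H_{\mathbf\Sigma}(@)$ omits state variables and $\forall$. $\sigma^\Box(\vec\phi):=\neg\sigma(\neg\vec\phi)$, $\exists x\phi:=\neg\forall x\neg\phi$. Semantics: model with $W_s\neq\emptyset$, $R_\sigma\subseteq W_s\times W_{s_1}\times\cdots\times W_{s_n}$, $w^c\in W_s$, $V_s:\mathrm{PROP}_s\cup\mathrm{NOM}_s\to\mathcal P(W_s)$ (nominals to singletons), $V^N_s(c)=\{w^c\}$; assignments $g_s:\mathrm{SVAR}_s\to W_s$. Atoms hold at $w$ iff $w\in V^N_s(a)$ (resp. $w=g_s(x)$); Boolean usual; $\sigma(\phi_1..\phi_n)$ iff some $w_i\in W_{s_i}$ with $R_\sigma ww_1..w_n$ satisfy $\phi_i$;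 $@^s_k\phi$ iff $\phi$ holds at the unique element of $V^N_t(k)$; $\forall x\phi$ iff $\phi$ holds under all $x$-variants of $g$. A formula of sort $t$ is valid in $\mathcal M$ if it holds at all $w\in W_t$ under all assignments. Systems ($j,k$ nominals or constant nominals): $\mathcal H_{\mathbf\Sigma}(@)$: axioms propositional tautology instances, $(K_\sigma)$ $\sigma^\Box(\dots,\phi\to\chi,\dots)\to(\sigma^\Box(\dots,\phi,\dots)\to\sigma^\Box(\dots,\chi,\dots))$, $(Dual_\sigma)$, (K@) $@^s_j(\phi\to\psi)\to(@^s_j\phi\to@^s_j\psi)$, (Agree) $@^t_k@^{t'}_j\phi\leftrightarrow@^t_j\phi$, (SelfDual) $@^s_j\phi\leftrightarrow\neg@^s_j\neg\phi$, (Intro) $j\to(\phi_s\leftrightarrow@^s_j\phi_s)$, (Back) $\sigma(\dots,@^{s_i}_j\psi,\dots)\to@^s_j\psi$, (Ref) $@^s_jj$; rules MP, (UG) from $\vdash_{s_i}\phi$ infer $\vdash_s\sigma^\Box(..,\phi,..)$, (BroadcastS) from $\vdash_s@^s_j\phi$ infer $\vdash_{s'}@^{s'}_j\phi$, (Gen@) from $\vdash_{s'}\phi$ infer $\vdash_s@^s_j\phi$, (Name@) from $\vdash_s@^s_j\phi$ infer $\vdash_{s'}\phi$ for nominal $j$ not in $\phi$, (Paste) from $\vdash_s@^s_j\sigma(..,k,..)\wedge@^s_k\phi\to\psi$ infer $\vdash_s@^s_j\sigma(..,\phi,..)\to\psi$ for nominal $k\neq j$ not in $\phi,\psi$, sorted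 uniform substitution. $\mathcal H_{\mathbf\Sigma}(@,\forall)$ adds (Q1) $\forall x(\phi\to\psi)\to(\phi\to\forall x\psi)$ ($x$ not free in $\phi$), (Q2) $\forall x\phi\to\phi[y/x]$, (Name) $\exists x\,x$, (Barcan) $\forall x\,\sigma^\Box(\phi_1,..,\phi_n)\to\sigma^\Box(\phi_1,..,\forall x\phi_i,..,\phi_n)$ ($x$ not free in $\phi_l$, $l\neq i$), (Barcan@) $\forall x@^s_j\phi\to@^s_j\forall x\phi$, (Nom x) $@^s_kx\wedge@^s_jx\to@^s_kj$, rule (Gen) from $\vdash_s\phi$ infer $\vdash_s\forall x\phi$. -}

module Defs where

open import Data.Nat using (ℕ)
open import Data.Bool using (Bool; true; false; not; _∨_)
open import Data.List using (List; []; _∷_)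
open import Data.List.Relation.Unary.All using (All)
open import Data.Product using (Σ; _×_; _,_)
open import Data.Sum using (_⊎_; inj₁; inj₂)
open import Data.Unit using (⊤)
open import Relation.Nullary using (¬_)
open import Relation.Binary.PropositionalEquality using (_≡_; _≢_)

-- Many-sorted signature  Σ = (S, Σ, N)
-- Sort : the set of sorts S
-- Op ss s : operation symbols of arity  s₁ ⋯ sₙ → s  (ss = s₁ ∷ ⋯ ∷ sₙ)
-- CNom s  : constant nominals of sort s
-- PROP_s, NOM_s, SVAR_s are countably infinite; each is represented by ℕ.
-- (Elements of different sorts are distinct: a nominal is a pair (s , n).)

record Sig : Set₁ where
  field
    Sort : Set
    Op   : List Sort → Sort → Set
    CNom : Sort → Set

data Logic : Set where
  hyb  : Logic   -- H_Σ(@)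
  hybQ : Logic   -- H_Σ(@,∀)

-- propositional formulas, used for "instances of propositional tautologies"
data PF : Set where
  pvar : ℕ → PF
  pneg : PF → PF
  por  : PF → PF → PF

evalPF : (ℕ → Bool) → PF → Bool
evalPF v (pvar n) = v n
evalPF v (pneg τ) = not (evalPF v τ)
evalPF v (por τ τ′) = evalPF v τ ∨ evalPF v τ′

Tautology : PF → Set
Tautology τ = (v : ℕ → Bool) → evalPF v τ ≡ true

module Hybrid (𝕊 : Sig) where
  open Sig 𝕊 public

  NomC : Sort → Set
  NomC s = ℕ ⊎ CNom s

  data Pos : List Sort → Sort → Set where
    here  : ∀ {t ts} → Pos (t ∷ ts) t
    there : ∀ {t t′ ts} → Pos ts t → Pos (t′ ∷ ts) t

  data Form : Logic → Sort → Set
  data Args : Logic → List Sort → Set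

  data Form where
    prop : ∀ {L s} → ℕ → Form L s
    nom  : ∀ {L s} → NomC s → Form L s
    svar : ∀ {s} → ℕ → Form hybQ s
    neg  : ∀ {L s} → Form L s → Form L s
    or   : ∀ {L s} → Form L s → Form L s → Form L s
    op   : ∀ {L ss s} → Op ss s → Args L ss → Form L s
    at   : ∀ {L s t} → NomC t → Form L t → Form L s
    all  : ∀ {s} (t : Sort) → ℕ → Form hybQ s → Form hybQ s

  data Args where
    []  : ∀ {L} → Args L []
    _∷_ : ∀ {L t ts} → Form L t → Args L ts → Args L (t ∷ ts)

  infixr 5 _∷_

  _⇒_ : ∀ {L s} → Form L s → Form L s → Form L s
  φ ⇒ ψ = or (neg φ) ψ

  _∧_ : ∀ {L s} → Form L s → Form L s → Form L s
  φ ∧ ψ = neg (or (neg φ) (neg ψ))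

  _⇔_ : ∀ {L s} → Form L s → Form L s → Form L s
  φ ⇔ ψ = (φ ⇒ ψ) ∧ (ψ ⇒ φ)

  infixr 6 _∧_
  infixr 5 _⇒_
  infix 4 _⇔_

  mapNeg : ∀ {L ss} → Args L ss → Args L ss
  mapNeg [] = []
  mapNeg (φ ∷ as) = neg φ ∷ mapNeg as

  box : ∀ {L ss s} → Op ss s → Args L ss → Form L s
  box σ as = neg (op σ (mapNeg as))

  ex : ∀ {s} (t : Sort) → ℕ → Form hybQ s → Form hybQ s
  ex t x φ = neg (all t x (neg φ))

  upd : ∀ {L ss t} → Args L ss → Pos ss t → Form L t → Args L ss
  upd (_ ∷ as) here ψ = ψ ∷ as
  upd (a ∷ as) (there i) ψ = a ∷ upd as i ψ

  inst : ∀ {L s} → (ℕ → Form L s) → PF → Form L s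
  inst θ (pvar n) = θ n
  inst θ (pneg τ) = neg (inst θ τ)
  inst θ (por τ τ′) = or (inst θ τ) (inst θ τ′)

  data NomOcc (t : Sort) (k : ℕ) : ∀ {L s} → Form L s → Set
  data NomOccArgs (t : Sort) (k : ℕ) : ∀ {L ss} → Args L ss → Set

  data NomOcc t k where
    o-nom  : ∀ {L} → NomOcc t k (nom {L} {t} (inj₁ k))
    o-neg  : ∀ {L s} {φ : Form L s} → NomOcc t k φ → NomOcc t k (neg φ)
    o-orl  : ∀ {L s} {φ ψ : Form L s} → NomOcc t k φ → NomOcc t k (or φ ψ)
    o-orr  : ∀ {L s} {φ ψ : Form L s} → NomOcc t k ψ → NomOcc t k (or φ ψ)
    o-op   : ∀ {L ss s} {σ : Op ss s} {as : Args L ss} → NomOccArgs t k as → NomOcc t k (op σ as)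
    o-atj  : ∀ {L s} {φ : Form L t} → NomOcc t k (at {L} {s} (inj₁ k) φ)
    o-at   : ∀ {L s u} {j : NomC u} {φ : Form L u} → NomOcc t k φ → NomOcc t k (at {L} {s} j φ)
    o-all  : ∀ {s u x} {φ : Form hybQ s} → NomOcc t k φ → NomOcc t k (all u x φ)

  data NomOccArgs t k where
    oa-here  : ∀ {L u us} {φ : Form L u} {as : Args L us} → NomOcc t k φ → NomOccArgs t k (φ ∷ as)
    oa-there : ∀ {L u us} {φ : Form L u} {as : Args L us} → NomOccArgs t k as → NomOccArgs t k (φ ∷ as)

  data Free (t : Sort) (x : ℕ) : ∀ {L s} → Form L s → Set
  data FreeArgs (t : Sort) (x : ℕ) : ∀ {L ss} → Args L ss → Set

  data Free t x where
    f-var : Free t x (svar {t} x)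
    f-neg : ∀ {L s} {φ : Form L s} → Free t x φ → Free t x (neg φ)
    f-orl : ∀ {L s} {φ ψ : Form L s} → Free t x φ → Free t x (or φ ψ)
    f-orr : ∀ {L s} {φ ψ : Form L s} → Free t x ψ → Free t x (or φ ψ)
    f-op  : ∀ {L ss s} {σ : Op ss s} {as : Args L ss} → FreeArgs t x as → Free t x (op σ as)
    f-at  : ∀ {L s u} {j : NomC u} {φ : Form L u} → Free t x φ → Free t x (at {L} {s} j φ)
    f-all : ∀ {s u y} {φ : Form hybQ s} → _≢_ {A = Sort × ℕ} (u , y) (t , x) →
            Free t x φ → Free t x (all u y φ)

  data FreeArgs t x where
    fa-here  : ∀ {L u us} {φ : Form L u} {as : Args L us} → Free t x φ → FreeArgs t x (φ ∷ as)
    fa-there : ∀ {L u us} {φ : Form L u} {as : Args L us} → FreeArgs t x as → FreeArgs t x (φ ∷ as)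

  OthersNotFree : ∀ {L ss u} (t : Sort) (x : ℕ) → Args L ss → Pos ss u → Set
  OthersNotFree t x (_ ∷ as) here = ¬ FreeArgs t x as
  OthersNotFree t x (a ∷ as) (there i) = ¬ Free t x a × OthersNotFree t x as i

  -- SubV t x y φ φ′ :  φ′ = φ[y/x]  (x, y ∈ SVAR_t), defined only when
  -- y is free for x in φ (no capture).

  data SubV (t : Sort) (x y : ℕ) : ∀ {L s} → Form L s → Form L s → Set
  data SubVArgs (t : Sort) (x y : ℕ) : ∀ {L ss} → Args L ss → Args L ss → Set

  data SubV t x y where
    sv-hit  : SubV t x y (svar {t} x) (svar {t} y)
    sv-miss : ∀ {s n} → _≢_ {A = Sort × ℕ} (s , n) (t , x) → SubV t x y (svar {s} n) (svar {s} n)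
    sv-prop : ∀ {L s p} → SubV t x y (prop {L} {s} p) (prop p)
    sv-nom  : ∀ {L s} {j : NomC s} → SubV t x y (nom {L} j) (nom j)
    sv-neg  : ∀ {L s} {φ φ′ : Form L s} → SubV t x y φ φ′ → SubV t x y (neg φ) (neg φ′)
    sv-or   : ∀ {L s} {φ φ′ ψ ψ′ : Form L s} → SubV t x y φ φ′ → SubV t x y ψ ψ′ →
              SubV t x y (or φ ψ) (or φ′ ψ′)
    sv-op   : ∀ {L ss s} {σ : Op ss s} {as as′ : Args L ss} → SubVArgs t x y as as′ →
              SubV t x y (op σ as) (op σ as′)
    sv-at   : ∀ {L s u} {j : NomC u} {φ φ′ : Form L u} → SubV t x y φ φ′ →
              SubV t x y (at {L} {s} j φ) (at j φ′)
    sv-all-bound : ∀ {s} {φ : Form hybQ s} → SubV t x y (all t x φ) (all t x φ)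
    sv-all  : ∀ {s u z} {φ φ′ : Form hybQ s} →
              _≢_ {A = Sort × ℕ} (u , z) (t , x) → _≢_ {A = Sort × ℕ} (u , z) (t , y) →
              SubV t x y φ φ′ → SubV t x y (all u z φ) (all u z φ′)
    sv-all-nf : ∀ {s u z} {φ : Form hybQ s} →
              _≢_ {A = Sort × ℕ} (u , z) (t , x) → ¬ Free t x φ →
              SubV t x y (all u z φ) (all u z φ)

  data SubVArgs t x y where
    []  : ∀ {L} → SubVArgs t x y {L} [] []
    _∷_ : ∀ {L u us} {φ φ′ : Form L u} {as as′ : Args L us} →
          SubV t x y φ φ′ → SubVArgs t x y as as′ → SubVArgs t x y (φ ∷ as) (φ′ ∷ as′)

  module USubst {L} (θp : (s : Sort) → ℕ → Form L s) (θn : (s : Sort) → ℕ → NomC s) where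

    subN : ∀ {s} → NomC s → NomC s
    subN {s} (inj₁ n) = θn s n
    subN (inj₂ c) = inj₂ c

    usub : ∀ {s} → Form L s → Form L s
    usubArgs : ∀ {ss} → Args L ss → Args L ss
    usub {s} (prop p) = θp s p
    usub (nom j) = nom (subN j)
    usub (svar x) = svar x
    usub (neg φ) = neg (usub φ)
    usub (or φ ψ) = or (usub φ) (usub ψ)
    usub (op σ as) = op σ (usubArgs as)
    usub (at j φ) = at (subN j) (usub φ)
    usub (all t x φ) = all t x (usub φ)
    usubArgs [] = []
    usubArgs (φ ∷ as) = usub φ ∷ usubArgs as

    -- no free state variable of a substituted formula gets captured
    -- (B = list of binders in scope)
    Safe : ∀ {s} → List (Sort × ℕ) → Form L s → Set
    SafeArgs : ∀ {ss} → List (Sort × ℕ) → Args L ss → Set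
    Safe {s} B (prop p) = All (λ { (t , x) → ¬ Free t x (θp s p) }) B
    Safe B (nom j) = ⊤
    Safe B (svar x) = ⊤
    Safe B (neg φ) = Safe B φ
    Safe B (or φ ψ) = Safe B φ × Safe B ψ
    Safe B (op σ as) = SafeArgs B as
    Safe B (at j φ) = Safe B φ
    Safe B (all t x φ) = Safe ((t , x) ∷ B) φ
    SafeArgs B [] = ⊤
    SafeArgs B (φ ∷ as) = Safe B φ × SafeArgs B as

  open USubst public

  data Prf : (L : Logic) (s : Sort) → Form L s → Set where
    taut     : ∀ {L s} (τ : PF) → Tautology τ → (θ : ℕ → Form L s) → Prf L s (inst θ τ)
    K-σ      : ∀ {L ss s t} (σ : Op ss s) (as : Args L ss) (i : Pos ss t) (φ χ : Form L t) →
               Prf L s (box σ (upd as i (φ ⇒ χ)) ⇒ (box σ (upd as i φ) ⇒ box σ (upd as i χ)))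
    Dual-σ   : ∀ {L ss s} (σ : Op ss s) (as : Args L ss) →
               Prf L s (op σ as ⇔ neg (box σ (mapNeg as)))
    K-at       : ∀ {L s t} (j : NomC t) (φ ψ : Form L t) →
               Prf L s (at j (φ ⇒ ψ) ⇒ (at j φ ⇒ at j ψ))
    Agree    : ∀ {L t t′ u} (k : NomC t′) (j : NomC u) (φ : Form L u) →
               Prf L t (at k (at {L} {t′} j φ) ⇔ at j φ)
    SelfDual : ∀ {L s t} (j : NomC t) (φ : Form L t) →
               Prf L s (at j φ ⇔ neg (at j (neg φ)))
    Intro    : ∀ {L s} (j : NomC s) (φ : Form L s) →
               Prf L s (nom j ⇒ (φ ⇔ at j φ))
    Back     : ∀ {L ss s t u} (σ : Op ss s) (as : Args L ss) (i : Pos ss t)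
               (j : NomC u) (ψ : Form L u) →
               Prf L s (op σ (upd as i (at j ψ)) ⇒ at j ψ)
    Ref      : ∀ {L s t} (j : NomC t) → Prf L s (at j (nom j))
    MP       : ∀ {L s} {φ ψ : Form L s} → Prf L s (φ ⇒ ψ) → Prf L s φ → Prf L s ψ
    UG       : ∀ {L ss s t} (σ : Op ss s) (as : Args L ss) (i : Pos ss t) (φ : Form L t) →
               Prf L t φ → Prf L s (box σ (upd as i φ))
    BroadcastS : ∀ {L s s′ t} (j : NomC t) (φ : Form L t) →
               Prf L s (at j φ) → Prf L s′ (at j φ)
    Gen-at     : ∀ {L s s′} (j : NomC s′) (φ : Form L s′) →
               Prf L s′ φ → Prf L s (at j φ)
    Name-at    : ∀ {L s s′} (j : ℕ) (φ : Form L s′) → ¬ NomOcc s′ j φ →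
               Prf L s (at (inj₁ j) φ) → Prf L s′ φ
    Paste    : ∀ {L ss s u t} (σ : Op ss u) (as : Args L ss) (i : Pos ss t)
               (j : NomC u) (k : ℕ) (φ : Form L t) (ψ : Form L s) →
               _≢_ {A = Σ Sort NomC} (u , j) (t , inj₁ k) →
               ¬ NomOcc t k (op σ (upd as i φ)) → ¬ NomOcc t k ψ →
               Prf L s ((at j (op σ (upd as i (nom (inj₁ k)))) ∧ at (inj₁ k) φ) ⇒ ψ) →
               Prf L s (at j (op σ (upd as i φ)) ⇒ ψ)
    USub     : ∀ {L s} (θp : (s : Sort) → ℕ → Form L s) (θn : (s : Sort) → ℕ → NomC s)
               (φ : Form L s) → Safe θp θn [] φ →
               Prf L s φ → Prf L s (usub θp θn φ)
    Q1       : ∀ {s} (t : Sort) (x : ℕ) (φ ψ : Form hybQ s) → ¬ Free t x φ →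
               Prf hybQ s (all t x (φ ⇒ ψ) ⇒ (φ ⇒ all t x ψ))
    Q2       : ∀ {s} (t : Sort) (x y : ℕ) (φ φ′ : Form hybQ s) → SubV t x y φ φ′ →
               Prf hybQ s (all t x φ ⇒ φ′)
    Name     : ∀ {s} (x : ℕ) → Prf hybQ s (ex s x (svar x))
    Barcan   : ∀ {ss s u} (σ : Op ss s) (as : Args hybQ ss) (i : Pos ss u) (φ : Form hybQ u)
               (t : Sort) (x : ℕ) → OthersNotFree t x as i →
               Prf hybQ s (all t x (box σ (upd as i φ)) ⇒ box σ (upd as i (all t x φ)))
    Barcan-at  : ∀ {s t} (j : NomC t) (φ : Form hybQ t) (u : Sort) (x : ℕ) →
               Prf hybQ s (all u x (at j φ) ⇒ at j (all u x φ))
    Nomx     : ∀ {s t} (x : ℕ) (j k : NomC t) →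
               Prf hybQ s ((at k (svar x) ∧ at j (svar x)) ⇒ at k (nom j))
    Gen      : ∀ {s} (t : Sort) (x : ℕ) {φ : Form hybQ s} →
               Prf hybQ s φ → Prf hybQ s (all t x φ)

  WTuple : (Sort → Set) → List Sort → Set
  WTuple W [] = ⊤
  WTuple W (t ∷ ts) = W t × WTuple W ts

  record Model : Set₁ where
    field
      W   : Sort → Set
      inh : (s : Sort) → W s
      R   : ∀ {ss s} → Op ss s → W s → WTuple W ss → Set
      wc  : ∀ {s} → CNom s → W s                       -- w^c, V^N_s(c) = {w^c}
      Vp  : (s : Sort) → ℕ → W s → Set
      Vn  : (s : Sort) → ℕ → W s                       -- V_s(j) = {Vn s j}

  module _ (M : Model) where
    open Model M

    Assignment : Set
    Assignment = (s : Sort) → ℕ → W s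

    den : ∀ {t} → NomC t → W t
    den {t} (inj₁ n) = Vn t n
    den (inj₂ c) = wc c

    Variant : (t : Sort) → ℕ → Assignment → Assignment → Set
    Variant t x g g′ = (s : Sort) (n : ℕ) → _≢_ {A = Sort × ℕ} (s , n) (t , x) → g′ s n ≡ g s n

    Sat : ∀ {L s} → Assignment → W s → Form L s → Set
    SatArgs : ∀ {L ss} → Assignment → WTuple W ss → Args L ss → Set
    Sat {s = s} g w (prop p) = Vp s p w
    Sat g w (nom j) = w ≡ den j
    Sat {s = s} g w (svar x) = w ≡ g s x
    Sat g w (neg φ) = ¬ Sat g w φ
    Sat g w (or φ ψ) = Sat g w φ ⊎ Sat g w ψ
    Sat {s = s} g w (op {ss = ss} σ as) = Σ (WTuple W ss) λ ws → R σ w ws × SatArgs g ws as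
    Sat g w (at j φ) = Sat g (den j) φ
    Sat g w (all t x φ) = (g′ : Assignment) → Variant t x g g′ → Sat g′ w φ
    SatArgs g _ [] = ⊤
    SatArgs g (w , ws) (φ ∷ as) = Sat g w φ × SatArgs g ws as

    Valid : ∀ {L t} → Form L t → Set
    Valid {t = t} φ = (g : Assignment) (w : W t) → Sat g w φ

  -- hypotheses  (s_i , j_i , γ_i)  with  j_i ∈ NOM_{s_i},  γ_i of sort s_i
  Hyp : Logic → Set
  Hyp L = Σ Sort λ t → ℕ × Form L t

  atHyp : ∀ {L} (s : Sort) → Hyp L → Form L s
  atHyp s (t , j , γ) = at (inj₁ j) γ

  -- @^s_{j₁}γ₁ ∧ ⋯ ∧ @^s_{jₙ}γₙ   (n ≥ 1; first hypothesis h, the rest hs)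
  conj : ∀ {L} (s : Sort) → Hyp L → List (Hyp L) → Form L s
  conj s h [] = atHyp s h
  conj s h (h′ ∷ hs) = atHyp s h ∧ conj s h′ hs

module Submission where

-- This is a consequence of the soundness of H_Σ(@) and H_Σ(@,∀): every
-- derivable formula is valid in every model.  Each @_{jᵢ}γᵢ then holds at every
-- world of M (it only looks at the world named jᵢ), so the conjunction does as
-- well, and modus ponens with the valid implication gives φ.
--
-- The metatheory is classical (excluded middle is a hypothesis), since the
-- object-level ⇒, ∧, ⇔ are defined from ¬ and ∨.

open import Defs
open import Level using (0ℓ)
open import Axiom.ExcludedMiddle using (ExcludedMiddle)
open import Axiom.DoubleNegationElimination using (em⇒dne)
open import Data.List using (List; []; _∷_)
open import Data.List.Relation.Unary.All as All using (All; []; _∷_)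
open import Data.List.Membership.Propositional using (_∈_)
open import Data.List.Relation.Unary.Any using (here; there)
open import Data.Product using (Σ; _×_; _,_; proj₁; proj₂)
open import Data.Sum using (_⊎_; inj₁; inj₂)
open import Data.Nat using (ℕ)
open import Data.Empty using (⊥; ⊥-elim)
open import Data.Unit using (tt)
open import Relation.Nullary using (¬_; yes; no; does; proof)
open import Relation.Nullary.Reflects using (Reflects; invert; ¬-reflects; _⊎-reflects_)
open import Relation.Binary.PropositionalEquality using (_≡_; _≢_; refl; sym; trans; subst)

module Soundness (𝕊 : Sig) (em : ExcludedMiddle 0ℓ) where
  open Hybrid 𝕊

  _↔_ : Set → Set → Set
  A ↔ B = (A → B) × (B → A)

  -- Classical reading of the derived connectives: Sat of φ ⇒ ψ unfolds to
  -- ¬ A ⊎ B, Sat of φ ∧ ψ to ¬ (¬ A ⊎ ¬ B).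
  dne : {A : Set} → ¬ ¬ A → A
  dne = em⇒dne em

  ⇒-intro : {A B : Set} → (A → B) → ¬ A ⊎ B
  ⇒-intro {A} f with em {A}
  ... | yes a = inj₂ (f a)
  ... | no ¬a = inj₁ ¬a

  ⇒-elim : {A B : Set} → ¬ A ⊎ B → A → B
  ⇒-elim (inj₁ ¬a) a = ⊥-elim (¬a a)
  ⇒-elim (inj₂ b) _ = b

  ∧-intro : {A B : Set} → A → B → ¬ (¬ A ⊎ ¬ B)
  ∧-intro a b (inj₁ ¬a) = ¬a a
  ∧-intro a b (inj₂ ¬b) = ¬b b

  ∧-elim₁ : {A B : Set} → ¬ (¬ A ⊎ ¬ B) → A
  ∧-elim₁ a∧b = dne (λ ¬a → a∧b (inj₁ ¬a))

  ∧-elim₂ : {A B : Set} → ¬ (¬ A ⊎ ¬ B) → B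
  ∧-elim₂ a∧b = dne (λ ¬b → a∧b (inj₂ ¬b))

  ⇔-intro : {A B : Set} → (A → B) → (B → A) → ¬ (¬ (¬ A ⊎ B) ⊎ ¬ (¬ B ⊎ A))
  ⇔-intro f g = ∧-intro (⇒-intro f) (⇒-intro g)

  counterexample : {A : Set} {P Q : A → Set} → ¬ (∀ a → P a → Q a) → Σ A λ a → P a × ¬ Q a
  counterexample ¬∀ = dne λ ¬∃ → ¬∀ λ a p → dne λ ¬q → ¬∃ (a , p , ¬q)

  Family : (Sort → Set) → Set
  Family F = (s : Sort) → ℕ → F s

  -- f with its value at (t , x) replaced by v.  Sorts have no decidable
  -- equality, so the case split uses excluded middle.
  update : {F : Sort → Set} → Family F → (t : Sort) → ℕ → F t → Family F
  update f t x v s n with em {_≡_ {A = Sort × ℕ} (t , x) (s , n)}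
  ... | yes refl = v
  ... | no _ = f s n

  update-hit : {F : Sort → Set} (f : Family F) (t : Sort) (x : ℕ) (v : F t) → update f t x v t x ≡ v
  update-hit f t x v with em {_≡_ {A = Sort × ℕ} (t , x) (t , x)}
  ... | yes refl = refl
  ... | no ne = ⊥-elim (ne refl)

  update-miss : {F : Sort → Set} (f : Family F) (t : Sort) (x : ℕ) (v : F t) {s : Sort} {n : ℕ} →
                _≢_ {A = Sort × ℕ} (s , n) (t , x) → update f t x v s n ≡ f s n
  update-miss f t x v {s} {n} ne with em {_≡_ {A = Sort × ℕ} (t , x) (s , n)}
  ... | yes refl = ⊥-elim (ne refl)
  ... | no _ = refl

  Except : {F : Sort → Set} (t : Sort) (x : ℕ) (f f′ : Family F) → Set
  Except t x f f′ = (s : Sort) (n : ℕ) → _≢_ {A = Sort × ℕ} (s , n) (t , x) → f′ s n ≡ f s n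

  update-except : {F : Sort → Set} (f : Family F) (t : Sort) (x : ℕ) (v : F t) → Except t x f (update f t x v)
  update-except f t x v s n = update-miss f t x v

  except-sym : {F : Sort → Set} {t : Sort} {x : ℕ} {f f′ : Family F} → Except t x f f′ → Except t x f′ f
  except-sym e s n ne = sym (e s n ne)

  except-agrees : {F : Sort → Set} {t : Sort} {x : ℕ} {f f′ : Family F} (P : Sort → ℕ → Set) →
                  Except t x f f′ → ¬ P t x → ∀ a n → P a n → f a n ≡ f′ a n
  except-agrees {t = t} {x} P e ¬P a n p with em {_≡_ {A = Sort × ℕ} (a , n) (t , x)}
  ... | yes refl = ⊥-elim (¬P p)
  ... | no ne = sym (e a n ne)

  withNominals : (M : Model) → Family (Model.W M) → Model
  withNominals M V = record M { Vn = V }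

  nominal-coincidence : ∀ {L s} (M : Model) (V : Family (Model.W M)) (φ : Form L s) →
      (∀ t n → NomOcc t n φ → Model.Vn M t n ≡ V t n) →
      ∀ g w → Sat M g w φ → Sat (withNominals M V) g w φ
  nominal-coincidenceArgs : ∀ {L ss} (M : Model) (V : Family (Model.W M)) (as : Args L ss) →
      (∀ t n → NomOccArgs t n as → Model.Vn M t n ≡ V t n) →
      ∀ g ws → SatArgs M g ws as → SatArgs (withNominals M V) g ws as
  nominal-coincidence M V (prop p) ag g w h = h
  nominal-coincidence M V (nom (inj₁ n)) ag g w h = trans h (ag _ n o-nom)
  nominal-coincidence M V (nom (inj₂ c)) ag g w h = h
  nominal-coincidence M V (svar x) ag g w h = h
  nominal-coincidence M V (neg φ) ag g w h b =
    h (nominal-coincidence (withNominals M V) (Model.Vn M) φ (λ t n o → sym (ag t n (o-neg o))) g w b)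
  nominal-coincidence M V (or φ ψ) ag g w (inj₁ a) =
    inj₁ (nominal-coincidence M V φ (λ t n o → ag t n (o-orl o)) g w a)
  nominal-coincidence M V (or φ ψ) ag g w (inj₂ b) =
    inj₂ (nominal-coincidence M V ψ (λ t n o → ag t n (o-orr o)) g w b)
  nominal-coincidence M V (op σ as) ag g w (ws , r , sa) =
    ws , r , nominal-coincidenceArgs M V as (λ t n o → ag t n (o-op o)) g ws sa
  nominal-coincidence M V (at (inj₁ n) φ) ag g w h =
    subst (λ v → Sat (withNominals M V) g v φ) (ag _ n o-atj)
          (nominal-coincidence M V φ (λ t m o → ag t m (o-at o)) g _ h)
  nominal-coincidence M V (at (inj₂ c) φ) ag g w h =
    nominal-coincidence M V φ (λ t m o → ag t m (o-at o)) g _ h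
  nominal-coincidence M V (all u y φ) ag g w H g′ v =
    nominal-coincidence M V φ (λ t n o → ag t n (o-all o)) g′ w (H g′ v)
  nominal-coincidenceArgs M V [] ag g ws sa = tt
  nominal-coincidenceArgs M V (φ ∷ as) ag g (w , ws) (a , sa) =
    nominal-coincidence M V φ (λ t n o → ag t n (oa-here o)) g w a ,
    nominal-coincidenceArgs M V as (λ t n o → ag t n (oa-there o)) g ws sa

  fresh-nominal : ∀ {L s} (M : Model) (t : Sort) (k : ℕ) (v : Model.W M t) (φ : Form L s) →
      ¬ NomOcc t k φ → ∀ g w → Sat M g w φ → Sat (withNominals M (update (Model.Vn M) t k v)) g w φ
  fresh-nominal M t k v φ ¬occ =
    nominal-coincidence M _ φ (except-agrees (λ a n → NomOcc a n φ) (update-except (Model.Vn M) t k v) ¬occ)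

  fresh-nominal⁻¹ : ∀ {L s} (M : Model) (t : Sort) (k : ℕ) (v : Model.W M t) (φ : Form L s) →
      ¬ NomOcc t k φ → ∀ g w → Sat (withNominals M (update (Model.Vn M) t k v)) g w φ → Sat M g w φ
  fresh-nominal⁻¹ M t k v φ ¬occ =
    nominal-coincidence (withNominals M (update (Model.Vn M) t k v)) (Model.Vn M) φ
      (except-agrees (λ a n → NomOcc a n φ) (except-sym (update-except (Model.Vn M) t k v)) ¬occ)

  component : {W : Sort → Set} {ss : List Sort} {t : Sort} → Pos ss t → WTuple W ss → W t
  component here (w , _) = w
  component (there i) (_ , ws) = component i ws

  module _ (M : Model) where
    open Model M using (W)

    variable-coincidence : ∀ {L s} (φ : Form L s) (g g′ : Assignment M) →
        (∀ t x → Free t x φ → g t x ≡ g′ t x) → ∀ w → Sat M g w φ → Sat M g′ w φ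
    variable-coincidenceArgs : ∀ {L ss} (as : Args L ss) (g g′ : Assignment M) →
        (∀ t x → FreeArgs t x as → g t x ≡ g′ t x) → ∀ ws → SatArgs M g ws as → SatArgs M g′ ws as
    variable-coincidence (prop p) g g′ ag w h = h
    variable-coincidence (nom j) g g′ ag w h = h
    variable-coincidence (svar x) g g′ ag w h = trans h (ag _ x f-var)
    variable-coincidence (neg φ) g g′ ag w h b =
      h (variable-coincidence φ g′ g (λ t x f → sym (ag t x (f-neg f))) w b)
    variable-coincidence (or φ ψ) g g′ ag w (inj₁ a) =
      inj₁ (variable-coincidence φ g g′ (λ t x f → ag t x (f-orl f)) w a)
    variable-coincidence (or φ ψ) g g′ ag w (inj₂ b) =
      inj₂ (variable-coincidence ψ g g′ (λ t x f → ag t x (f-orr f)) w b)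
    variable-coincidence (op σ as) g g′ ag w (ws , r , sa) =
      ws , r , variable-coincidenceArgs as g g′ (λ t x f → ag t x (f-op f)) ws sa
    variable-coincidence (at j φ) g g′ ag w h =
      variable-coincidence φ g g′ (λ t x f → ag t x (f-at f)) (den M j) h
    variable-coincidence (all u y φ) g g′ ag w H h′ h′-var =
      variable-coincidence φ h h′ h-agrees w (H h h-var)
      where
        -- the u,y-variant of g that agrees with h′ on y
        h : Assignment M
        h = update g u y (h′ u y)
        h-var : Variant M u y g h
        h-var = update-except g u y (h′ u y)
        h-agrees : ∀ t x → Free t x φ → h t x ≡ h′ t x
        h-agrees t x f with em {_≡_ {A = Sort × ℕ} (t , x) (u , y)}
        ... | yes refl = update-hit g u y (h′ u y)
        ... | no ne = trans (update-miss g u y (h′ u y) ne)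
                        (trans (ag t x (f-all (λ e → ne (sym e)) f)) (sym (h′-var t x ne)))
    variable-coincidenceArgs [] g g′ ag ws sa = tt
    variable-coincidenceArgs (φ ∷ as) g g′ ag (w , ws) (a , sa) =
      variable-coincidence φ g g′ (λ t x f → ag t x (fa-here f)) w a ,
      variable-coincidenceArgs as g g′ (λ t x f → ag t x (fa-there f)) ws sa

    variable-coincidence-↔ : ∀ {L s} (φ : Form L s) (g g′ : Assignment M) →
        (∀ t x → Free t x φ → g t x ≡ g′ t x) → ∀ w → Sat M g w φ ↔ Sat M g′ w φ
    variable-coincidence-↔ φ g g′ ag w =
      variable-coincidence φ g g′ ag w , variable-coincidence φ g′ g (λ t x f → sym (ag t x f)) w

    not-free-invariant : ∀ {L s t x} (φ : Form L s) {g g′ : Assignment M} → ¬ Free t x φ →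
        Variant M t x g g′ → ∀ w → Sat M g w φ ↔ Sat M g′ w φ
    not-free-invariant φ ¬free var =
      variable-coincidence-↔ φ _ _ (except-agrees (λ a n → Free a n φ) var ¬free)

    -- g′ arises from g by moving x to the current value of y; this is how
    -- φ[y/x] at g relates to φ at g′.
    Shifted : (t : Sort) (x y : ℕ) (g g′ : Assignment M) → Set
    Shifted t x y g g′ = g′ t x ≡ g t y × Variant M t x g g′

    -- Under a binder ∀z with z ∉ {x, y}, shifted pairs of assignments can be
    -- varied at z together, starting from either side.
    shift-variant-right : ∀ {t x y u z} {g g′ : Assignment M} →
        _≢_ {A = Sort × ℕ} (u , z) (t , x) → _≢_ {A = Sort × ℕ} (u , z) (t , y) →
        Shifted t x y g g′ → (h′ : Assignment M) → Variant M u z g′ h′ →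
        Σ (Assignment M) λ h → Variant M u z g h × Shifted t x y h h′
    shift-variant-right {t} {x} {y} {u} {z} {g} {g′} zx zy (moved , var) h′ h′-var =
      h , h-var , h-moved , except-sym (update-except h′ t x (g t x))
      where
        h : Assignment M
        h = update h′ t x (g t x)
        h-var : Variant M u z g h
        h-var a n ne with em {_≡_ {A = Sort × ℕ} (a , n) (t , x)}
        ... | yes refl = update-hit h′ t x (g t x)
        ... | no ne′ = trans (update-miss h′ t x (g t x) ne′) (trans (h′-var a n ne) (var a n ne′))
        h-y : h t y ≡ g t y
        h-y with em {_≡_ {A = Sort × ℕ} (t , y) (t , x)}
        ... | yes refl = update-hit h′ t x (g t x)
        ... | no ne = trans (update-miss h′ t x (g t x) ne)
                        (trans (h′-var t y (λ e → zy (sym e))) (var t y ne))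
        h-moved : h′ t x ≡ h t y
        h-moved = trans (h′-var t x (λ e → zx (sym e))) (trans moved (sym h-y))

    shift-variant-left : ∀ {t x y u z} {g g′ : Assignment M} →
        _≢_ {A = Sort × ℕ} (u , z) (t , y) →
        Shifted t x y g g′ → (h : Assignment M) → Variant M u z g h →
        Σ (Assignment M) λ h′ → Variant M u z g′ h′ × Shifted t x y h h′
    shift-variant-left {t} {x} {y} {u} {z} {g} {g′} zy (moved , var) h h-var =
      h′ , h′-var , update-hit h t x (h t y) , update-except h t x (h t y)
      where
        h′ : Assignment M
        h′ = update h t x (h t y)
        h′-var : Variant M u z g′ h′
        h′-var a n ne with em {_≡_ {A = Sort × ℕ} (a , n) (t , x)}
        ... | yes refl = trans (update-hit h t x (h t y)) (trans (h-var t y (λ e → zy (sym e))) (sym moved))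
        ... | no ne′ = trans (update-miss h t x (h t y) ne′) (trans (h-var a n ne) (sym (var a n ne′)))

    substitution : ∀ {L s t x y} {φ φ′ : Form L s} → SubV t x y φ φ′ →
        (g g′ : Assignment M) → Shifted t x y g g′ → ∀ w → Sat M g w φ′ ↔ Sat M g′ w φ
    substitutionArgs : ∀ {L ss t x y} {as as′ : Args L ss} → SubVArgs t x y as as′ →
        (g g′ : Assignment M) → Shifted t x y g g′ → ∀ ws → SatArgs M g ws as′ ↔ SatArgs M g′ ws as
    substitution sv-hit g g′ (moved , _) w = (λ h → trans h (sym moved)) , (λ h → trans h moved)
    substitution (sv-miss ne) g g′ (_ , var) w =
      (λ h → trans h (sym (var _ _ ne))) , (λ h → trans h (var _ _ ne))
    substitution sv-prop g g′ sh w = (λ h → h) , (λ h → h)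
    substitution sv-nom g g′ sh w = (λ h → h) , (λ h → h)
    substitution (sv-neg sb) g g′ sh w = (λ h a → h (proj₂ ih a)) , (λ h a → h (proj₁ ih a))
      where ih = substitution sb g g′ sh w
    substitution (sv-or sb₁ sb₂) g g′ sh w =
      (λ { (inj₁ a) → inj₁ (proj₁ ih₁ a) ; (inj₂ b) → inj₂ (proj₁ ih₂ b) }) ,
      (λ { (inj₁ a) → inj₁ (proj₂ ih₁ a) ; (inj₂ b) → inj₂ (proj₂ ih₂ b) })
      where ih₁ = substitution sb₁ g g′ sh w
            ih₂ = substitution sb₂ g g′ sh w
    substitution (sv-op sa) g g′ sh w =
      (λ { (ws , r , x) → ws , r , proj₁ (substitutionArgs sa g g′ sh ws) x }) ,
      (λ { (ws , r , x) → ws , r , proj₂ (substitutionArgs sa g g′ sh ws) x })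
    substitution (sv-at {j = j} sb) g g′ sh w = substitution sb g g′ sh (den M j)
    substitution sv-all-bound g g′ (_ , var) w =
      (λ H h h-var → H h (λ a n ne → trans (h-var a n ne) (var a n ne))) ,
      (λ H h h-var → H h (λ a n ne → trans (h-var a n ne) (sym (var a n ne))))
    substitution (sv-all {u = u} {z} {φ} {φ′} zx zy sb) g g′ sh w = fwd , bwd
      where
        fwd : Sat M g w (all u z φ′) → Sat M g′ w (all u z φ)
        fwd H h′ h′-var with shift-variant-right zx zy sh h′ h′-var
        ... | h , h-var , sh′ = proj₁ (substitution sb h h′ sh′ w) (H h h-var)
        bwd : Sat M g′ w (all u z φ) → Sat M g w (all u z φ′)
        bwd H h h-var with shift-variant-left zy sh h h-var
        ... | h′ , h′-var , sh′ = proj₂ (substitution sb h h′ sh′ w) (H h′ h′-var)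
    substitution (sv-all-nf {φ = φ} zx ¬free) g g′ (_ , var) w =
      not-free-invariant (all _ _ φ) (λ { (f-all _ f) → ¬free f }) var w
    substitutionArgs [] g g′ sh ws = (λ h → h) , (λ h → h)
    substitutionArgs (sb ∷ sa) g g′ sh (w , ws) =
      (λ { (a , b) → proj₁ (substitution sb g g′ sh w) a , proj₁ (substitutionArgs sa g g′ sh ws) b }) ,
      (λ { (a , b) → proj₂ (substitution sb g g′ sh w) a , proj₂ (substitutionArgs sa g g′ sh ws) b })

    module UniformSubstitution {L} (θp : (s : Sort) → ℕ → Form L s) (θn : (s : Sort) → ℕ → NomC s)
                               (g₀ : Assignment M) where
      substitutedModel : Model
      substitutedModel = record M { Vp = λ s p w → Sat M g₀ w (θp s p) ; Vn = λ s n → den M (θn s n) }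

      -- B lists the binders passed so
      -- far; outside of them g agrees with g₀.
      uniform-substitution : ∀ {s} (B : List (Sort × ℕ)) (φ : Form L s) → Safe θp θn B φ →
          (g : Assignment M) → (∀ t x → ¬ ((t , x) ∈ B) → g t x ≡ g₀ t x) →
          ∀ w → Sat M g w (usub θp θn φ) ↔ Sat substitutedModel g w φ
      uniform-substitutionArgs : ∀ {ss} (B : List (Sort × ℕ)) (as : Args L ss) → SafeArgs θp θn B as →
          (g : Assignment M) → (∀ t x → ¬ ((t , x) ∈ B) → g t x ≡ g₀ t x) →
          ∀ ws → SatArgs M g ws (usubArgs θp θn as) ↔ SatArgs substitutedModel g ws as
      uniform-substitution {s} B (prop p) safe g g≡g₀ = variable-coincidence-↔ (θp s p) g g₀ agree
        where
          agree : ∀ t x → Free t x (θp s p) → g t x ≡ g₀ t x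
          agree t x f with em {(t , x) ∈ B}
          ... | yes bound = ⊥-elim (All.lookup safe bound f)
          ... | no unbound = g≡g₀ t x unbound
      uniform-substitution B (nom (inj₁ n)) safe g g≡g₀ w = (λ h → h) , (λ h → h)
      uniform-substitution B (nom (inj₂ c)) safe g g≡g₀ w = (λ h → h) , (λ h → h)
      uniform-substitution B (svar x) safe g g≡g₀ w = (λ h → h) , (λ h → h)
      uniform-substitution B (neg φ) safe g g≡g₀ w = (λ h a → h (proj₂ ih a)) , (λ h a → h (proj₁ ih a))
        where ih = uniform-substitution B φ safe g g≡g₀ w
      uniform-substitution B (or φ ψ) (safe₁ , safe₂) g g≡g₀ w =
        (λ { (inj₁ a) → inj₁ (proj₁ ih₁ a) ; (inj₂ b) → inj₂ (proj₁ ih₂ b) }) ,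
        (λ { (inj₁ a) → inj₁ (proj₂ ih₁ a) ; (inj₂ b) → inj₂ (proj₂ ih₂ b) })
        where ih₁ = uniform-substitution B φ safe₁ g g≡g₀ w
              ih₂ = uniform-substitution B ψ safe₂ g g≡g₀ w
      uniform-substitution B (op σ as) safe g g≡g₀ w =
        (λ { (ws , r , x) → ws , r , proj₁ (uniform-substitutionArgs B as safe g g≡g₀ ws) x }) ,
        (λ { (ws , r , x) → ws , r , proj₂ (uniform-substitutionArgs B as safe g g≡g₀ ws) x })
      uniform-substitution B (at (inj₁ n) φ) safe g g≡g₀ w = uniform-substitution B φ safe g g≡g₀ _
      uniform-substitution B (at (inj₂ c) φ) safe g g≡g₀ w = uniform-substitution B φ safe g g≡g₀ _
      uniform-substitution B (all t x φ) safe g g≡g₀ w =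
        (λ H h h-var → proj₁ (uniform-substitution _ φ safe h (h≡g₀ h h-var) w) (H h h-var)) ,
        (λ H h h-var → proj₂ (uniform-substitution _ φ safe h (h≡g₀ h h-var) w) (H h h-var))
        where
          h≡g₀ : (h : Assignment M) → Variant M t x g h →
                 ∀ a n → ¬ ((a , n) ∈ ((t , x) ∷ B)) → h a n ≡ g₀ a n
          h≡g₀ h h-var a n unbound =
            trans (h-var a n (λ e → unbound (here e))) (g≡g₀ a n (λ m → unbound (there m)))
      uniform-substitutionArgs B [] safe g g≡g₀ ws = (λ h → h) , (λ h → h)
      uniform-substitutionArgs B (φ ∷ as) (safe₁ , safe₂) g g≡g₀ (w , ws) =
        (λ { (a , b) → proj₁ (uniform-substitution B φ safe₁ g g≡g₀ w) a ,
                       proj₁ (uniform-substitutionArgs B as safe₂ g g≡g₀ ws) b }) ,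
        (λ { (a , b) → proj₂ (uniform-substitution B φ safe₁ g g≡g₀ w) a ,
                       proj₂ (uniform-substitutionArgs B as safe₂ g g≡g₀ ws) b })

    instance-reflects : ∀ {L s} (g : Assignment M) (w : W s) (θ : ℕ → Form L s) (τ : PF) →
        Reflects (Sat M g w (inst θ τ)) (evalPF (λ n → does (em {Sat M g w (θ n)})) τ)
    instance-reflects g w θ (pvar n) = proof em
    instance-reflects g w θ (pneg τ) = ¬-reflects (instance-reflects g w θ τ)
    instance-reflects g w θ (por τ τ′) = instance-reflects g w θ τ ⊎-reflects instance-reflects g w θ τ′

    sat-upd : ∀ {L ss t} (as : Args L ss) (i : Pos ss t) {A : Form L t} (g : Assignment M) ws →
        SatArgs M g ws (upd as i A) → Sat M g (component i ws) A
    sat-upd (a ∷ as) here g (w , ws) (x , _) = x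
    sat-upd (a ∷ as) (there i) g (w , ws) (_ , r) = sat-upd as i g ws r

    sat-neg-upd : ∀ {L ss t} (as : Args L ss) (i : Pos ss t) {A : Form L t} (g : Assignment M) ws →
        SatArgs M g ws (mapNeg (upd as i A)) → ¬ Sat M g (component i ws) A
    sat-neg-upd (a ∷ as) here g (w , ws) (x , _) = x
    sat-neg-upd (a ∷ as) (there i) g (w , ws) (_ , r) = sat-neg-upd as i g ws r

    replace-neg-arg : ∀ {L ss t} (as : Args L ss) (i : Pos ss t) {A B : Form L t} (g : Assignment M) ws →
        SatArgs M g ws (mapNeg (upd as i A)) → ¬ Sat M g (component i ws) B →
        SatArgs M g ws (mapNeg (upd as i B))
    replace-neg-arg (a ∷ as) here g (w , ws) (_ , r) ¬b = ¬b , r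
    replace-neg-arg (a ∷ as) (there i) g (w , ws) (x , r) ¬b = x , replace-neg-arg as i g ws r ¬b

    replace-neg-arg-variant : ∀ {L ss u t x} (as : Args L ss) (i : Pos ss u) {A B : Form L u}
        {g g′ : Assignment M} ws → OthersNotFree t x as i → Variant M t x g g′ →
        SatArgs M g ws (mapNeg (upd as i A)) → ¬ Sat M g′ (component i ws) B →
        SatArgs M g′ ws (mapNeg (upd as i B))
    replace-neg-arg-variant {t = t} {x} (a ∷ as) here {g = g} {g′} (w , ws) ¬free var (_ , r) ¬b =
      ¬b , transfer as ws ¬free r
      where
        transfer : ∀ {L ss} (as : Args L ss) ws → ¬ FreeArgs t x as →
            SatArgs M g ws (mapNeg as) → SatArgs M g′ ws (mapNeg as)
        transfer [] ws ¬free tt = tt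
        transfer (a ∷ as) (w , ws) ¬free (x , r) =
          proj₁ (not-free-invariant (neg a) (λ { (f-neg f) → ¬free (fa-here f) }) var w) x ,
          transfer as ws (λ f → ¬free (fa-there f)) r
    replace-neg-arg-variant (a ∷ as) (there i) (w , ws) (¬free , ¬free-rest) var (x , r) ¬b =
      proj₁ (not-free-invariant (neg a) (λ { (f-neg f) → ¬free f }) var w) x ,
      replace-neg-arg-variant as i ws ¬free-rest var r ¬b

    sat-double-negation : ∀ {L ss} (as : Args L ss) (g : Assignment M) ws →
        SatArgs M g ws (mapNeg (mapNeg as)) ↔ SatArgs M g ws as
    sat-double-negation [] g ws = (λ h → h) , (λ h → h)
    sat-double-negation (a ∷ as) g (w , ws) =
      (λ { (x , y) → dne x , proj₁ (sat-double-negation as g ws) y }) ,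
      (λ { (x , y) → (λ ¬x → ¬x x) , proj₂ (sat-double-negation as g ws) y })

  occurs-upd : ∀ {L ss t k} (as : Args L ss) (i : Pos ss t) {A : Form L t} →
      NomOcc t k A → NomOccArgs t k (upd as i A)
  occurs-upd (a ∷ as) here o = oa-here o
  occurs-upd (a ∷ as) (there i) o = oa-there (occurs-upd as i o)

  den-update : (M : Model) (t : Sort) (k : ℕ) (v : Model.W M t) {u : Sort} (j : NomC u) →
      _≢_ {A = Σ Sort NomC} (u , j) (t , inj₁ k) →
      den (withNominals M (update (Model.Vn M) t k v)) j ≡ den M j
  den-update M t k v (inj₁ n) ne = update-miss (Model.Vn M) t k v (λ { refl → ne refl })
  den-update M t k v (inj₂ c) ne = refl

  name-argument : ∀ {L ss t} (M : Model) (as : Args L ss) (i : Pos ss t) {φ : Form L t} (k : ℕ)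
      (g : Assignment M) ws → ¬ NomOccArgs t k (upd as i φ) → SatArgs M g ws (upd as i φ) →
      SatArgs (withNominals M (update (Model.Vn M) t k (component i ws))) g ws (upd as i (nom (inj₁ k)))
  name-argument {t = t} M (a ∷ as) here k g (w , ws) ¬occ (_ , r) =
    sym (update-hit (Model.Vn M) t k w) ,
    nominal-coincidenceArgs M _ as
      (except-agrees (λ a n → NomOccArgs a n as) (update-except (Model.Vn M) t k w) (λ o → ¬occ (oa-there o)))
      g ws r
  name-argument {t = t} M (a ∷ as) (there i) k g (w , ws) ¬occ (x , r) =
    fresh-nominal M t k (component i ws) a (λ o → ¬occ (oa-here o)) g w x ,
    name-argument M as i k g ws (λ o → ¬occ (oa-there o)) r

  ⊨_ : ∀ {L s} → Form L s → Set₁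
  ⊨ φ = (M : Model) → Valid M φ

  taut-valid : ∀ {L s} (τ : PF) → Tautology τ → (θ : ℕ → Form L s) → ⊨ inst θ τ
  taut-valid τ tautology θ M g w = invert (subst (Reflects _) (tautology _) (instance-reflects M g w θ τ))

  -- (K_σ) a σ-tuple refuting χ at position i refutes φ or φ ⇒ χ there.
  K-σ-valid : ∀ {L ss s t} (σ : Op ss s) (as : Args L ss) (i : Pos ss t) (φ χ : Form L t) →
      ⊨ (box σ (upd as i (φ ⇒ χ)) ⇒ (box σ (upd as i φ) ⇒ box σ (upd as i χ)))
  K-σ-valid σ as i φ χ M g w =
    ⇒-intro λ □φ⇒χ → ⇒-intro λ □φ → λ { (ws , r , sa) → refute □φ⇒χ □φ ws r sa }
    where
      refute : Sat M g w (box σ (upd as i (φ ⇒ χ))) → Sat M g w (box σ (upd as i φ)) →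
               ∀ ws → Model.R M σ w ws → SatArgs M g ws (mapNeg (upd as i χ)) → ⊥
      refute □φ⇒χ □φ ws r sa with em {Sat M g (component i ws) φ}
      ... | yes φ-holds = □φ⇒χ (ws , r , replace-neg-arg M as i g ws sa
                                           (λ φ⇒χ → sat-neg-upd M as i g ws sa (⇒-elim φ⇒χ φ-holds)))
      ... | no ¬φ = □φ (ws , r , replace-neg-arg M as i g ws sa ¬φ)

  Dual-σ-valid : ∀ {L ss s} (σ : Op ss s) (as : Args L ss) → ⊨ (op σ as ⇔ neg (box σ (mapNeg as)))
  Dual-σ-valid σ as M g w =
    ⇔-intro {A = Sat M g w (op σ as)}
      (λ { (ws , r , sa) ¬◇ → ¬◇ (ws , r , proj₂ (sat-double-negation M as g ws) sa) })
            (λ ¬¬◇ → let (ws , r , sa) = dne ¬¬◇ in ws , r , proj₁ (sat-double-negation M as g ws) sa)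

  -- (Name@) reinterpret the fresh nominal j as the world of evaluation.
  Name-at-sound : ∀ {L s s′} (j : ℕ) (φ : Form L s′) → ¬ NomOcc s′ j φ →
      ⊨ (at {L} {s} (inj₁ j) φ) → ⊨ φ
  Name-at-sound {s = s} {s′} j φ ¬occ valid-at M g w =
    fresh-nominal⁻¹ M s′ j w φ ¬occ g w
      (subst (λ v → Sat M′ g v φ) (update-hit (Model.Vn M) s′ j w) (valid-at M′ g (Model.inh M s)))
    where M′ = withNominals M (update (Model.Vn M) s′ j w)

  -- (Paste) reinterpret the fresh nominal k as the i-th successor world.
  Paste-sound : ∀ {L ss s u t} (σ : Op ss u) (as : Args L ss) (i : Pos ss t)
      (j : NomC u) (k : ℕ) (φ : Form L t) (ψ : Form L s) →
      _≢_ {A = Σ Sort NomC} (u , j) (t , inj₁ k) →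
      ¬ NomOcc t k (op σ (upd as i φ)) → ¬ NomOcc t k ψ →
      ⊨ ((at j (op σ (upd as i (nom (inj₁ k)))) ∧ at (inj₁ k) φ) ⇒ ψ) →
      ⊨ (at j (op σ (upd as i φ)) ⇒ ψ)
  Paste-sound {t = t} σ as i j k φ ψ j≢k ¬occ ¬occψ premise M g w =
    ⇒-intro λ { (ws , r , sa) → conclude ws r sa }
    where
      conclude : ∀ ws → Model.R M σ (den M j) ws → SatArgs M g ws (upd as i φ) → Sat M g w ψ
      conclude ws r sa =
        fresh-nominal⁻¹ M t k v ψ ¬occψ g w (⇒-elim (premise M′ g w) (∧-intro successor-named k-names-φ))
        where
          v = component i ws
          M′ = withNominals M (update (Model.Vn M) t k v)
          ¬occ-args : ¬ NomOccArgs t k (upd as i φ)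
          ¬occ-args o = ¬occ (o-op o)
          successor-named : Sat M′ g w (at j (op σ (upd as i (nom (inj₁ k)))))
          successor-named = ws , subst (λ z → Model.R M σ z ws) (sym (den-update M t k v j j≢k)) r ,
                            name-argument M as i k g ws ¬occ-args sa
          k-names-φ : Sat M′ g w (at (inj₁ k) φ)
          k-names-φ = subst (λ z → Sat M′ g z φ) (sym (update-hit (Model.Vn M) t k v))
                        (fresh-nominal M t k v φ (λ o → ¬occ-args (occurs-upd as i o)) g v
                          (sat-upd M as i g ws sa))

  -- (USub) a substitution instance is evaluated in the substituted model.
  USub-sound : ∀ {L s} (θp : (s : Sort) → ℕ → Form L s) (θn : (s : Sort) → ℕ → NomC s)
      (φ : Form L s) → Safe θp θn [] φ → ⊨ φ → ⊨ usub θp θn φ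
  USub-sound θp θn φ safe ⊨φ M g w =
    proj₂ (uniform-substitution [] φ safe g (λ _ _ _ → refl) w) (⊨φ substitutedModel g w)
    where open UniformSubstitution M θp θn g

  -- (Q1) φ is unaffected by x-variants when x is not free in φ.
  Q1-valid : ∀ {s} (t : Sort) (x : ℕ) (φ ψ : Form hybQ s) → ¬ Free t x φ →
      ⊨ (all t x (φ ⇒ ψ) ⇒ (φ ⇒ all t x ψ))
  Q1-valid t x φ ψ ¬free M g w = ⇒-intro λ ∀φ⇒ψ → ⇒-intro λ φ-holds → λ h h-var →
    ⇒-elim (∀φ⇒ψ h h-var) (proj₁ (not-free-invariant M φ ¬free h-var w) φ-holds)

  -- (Q2) instantiate ∀x at the x-variant sending x to the value of y.
  Q2-valid : ∀ {s} (t : Sort) (x y : ℕ) (φ φ′ : Form hybQ s) → SubV t x y φ φ′ → ⊨ (all t x φ ⇒ φ′)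
  Q2-valid t x y φ φ′ sb M g w =
    ⇒-intro λ ∀φ → proj₂ (substitution M sb g g′ shifted w) (∀φ g′ (proj₂ shifted))
    where
      g′ = update g t x (g t y)
      shifted : Shifted M t x y g g′
      shifted = update-hit g t x (g t y) , update-except g t x (g t y)

  -- (Name) the x-variant sending x to the current world witnesses ∃x x.
  Name-valid : ∀ {s} (x : ℕ) → ⊨ (ex s x (svar x))
  Name-valid {s} x M g w ∀¬x = ∀¬x (update g s x w) (update-except g s x w) (sym (update-hit g s x w))

  -- (Barcan) a tuple refuting ∀x φ at position i refutes φ under some
  -- x-variant, which leaves the other (x-free) arguments unchanged.
  Barcan-valid : ∀ {ss s u} (σ : Op ss s) (as : Args hybQ ss) (i : Pos ss u) (φ : Form hybQ u)
      (t : Sort) (x : ℕ) → OthersNotFree t x as i →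
      ⊨ (all t x (box σ (upd as i φ)) ⇒ box σ (upd as i (all t x φ)))
  Barcan-valid σ as i φ t x ¬free M g w = ⇒-intro λ ∀□ → λ { (ws , r , sa) → refute ∀□ ws r sa }
    where
      refute : Sat M g w (all t x (box σ (upd as i φ))) →
               ∀ ws → Model.R M σ w ws → SatArgs M g ws (mapNeg (upd as i (all t x φ))) → ⊥
      refute ∀□ ws r sa with counterexample (sat-neg-upd M as i g ws sa)
      ... | g′ , g′-var , ¬φ =
        ∀□ g′ g′-var (ws , r , replace-neg-arg-variant M as i ws ¬free g′-var sa ¬φ)

  soundness : ∀ {L s} {φ : Form L s} → Prf L s φ → ⊨ φ
  soundness (taut τ tautology θ) = taut-valid τ tautology θ
  soundness (K-σ σ as i φ χ) = K-σ-valid σ as i φ χ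
  soundness (Dual-σ σ as) = Dual-σ-valid σ as
  soundness (K-at j φ ψ) M g w = ⇒-intro λ φ⇒ψ → ⇒-intro λ φ-holds → ⇒-elim φ⇒ψ φ-holds
  soundness (Agree k j φ) M g w = ⇔-intro (λ a → a) (λ a → a)
  soundness (SelfDual j φ) M g w = ⇔-intro (λ a ¬a → ¬a a) dne
  soundness (Intro j φ) M g w = ⇒-intro λ w≡j →
    ⇔-intro (subst (λ v → Sat M g v φ) w≡j) (subst (λ v → Sat M g v φ) (sym w≡j))
  soundness (Back σ as i j ψ) M g w = ⇒-intro λ { (ws , r , sa) → sat-upd M as i g ws sa }
  soundness (Ref j) M g w = refl
  soundness (MP ⊢φ⇒ψ ⊢φ) M g w = ⇒-elim (soundness ⊢φ⇒ψ M g w) (soundness ⊢φ M g w)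
  soundness (UG σ as i φ ⊢φ) M g w (ws , r , sa) =
    sat-neg-upd M as i g ws sa (soundness ⊢φ M g (component i ws))
  soundness (BroadcastS {s = s} j φ ⊢at) M g w = soundness ⊢at M g (Model.inh M s)
  soundness (Gen-at j φ ⊢φ) M g w = soundness ⊢φ M g (den M j)
  soundness (Name-at j φ ¬occ ⊢at) = Name-at-sound j φ ¬occ (soundness ⊢at)
  soundness (Paste σ as i j k φ ψ j≢k ¬occ ¬occψ ⊢premise) =
    Paste-sound σ as i j k φ ψ j≢k ¬occ ¬occψ (soundness ⊢premise)
  soundness (USub θp θn φ safe ⊢φ) = USub-sound θp θn φ safe (soundness ⊢φ)
  soundness (Q1 t x φ ψ ¬free) = Q1-valid t x φ ψ ¬free
  soundness (Q2 t x y φ φ′ sb) = Q2-valid t x y φ φ′ sb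
  soundness (Name x) = Name-valid x
  soundness (Barcan σ as i φ t x ¬free) = Barcan-valid σ as i φ t x ¬free
  soundness (Barcan-at j φ u x) M g w = ⇒-intro λ all-at → all-at
  soundness (Nomx x j k) M g w = ⇒-intro λ both → trans (∧-elim₁ both) (sym (∧-elim₂ both))
  soundness (Gen t x ⊢φ) M g w h h-var = soundness ⊢φ M h w

  conj-holds : ∀ {L} (M : Model) (s : Sort) (h : Hyp L) (hs : List (Hyp L)) →
      All (λ { (t , j , γ) → Valid M γ }) (h ∷ hs) → ∀ g w → Sat M g w (conj s h hs)
  conj-holds M s h [] (γ-valid ∷ _) g w = γ-valid g _
  conj-holds M s h (h′ ∷ hs) (γ-valid ∷ rest) g w = ∧-intro (γ-valid g _) (conj-holds M s h′ hs rest g w)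

mainTheorem11 : (𝕊 : Sig) → let open Hybrid 𝕊 in
    ExcludedMiddle 0ℓ →
    (L : Logic) (Γ : (t : Sort) → Form L t → Set) (s : Sort) (φ : Form L s)
    (h : Hyp L) (hs : List (Hyp L)) →
    All (λ { (t , j , γ) → Γ t γ }) (h ∷ hs) →
    Prf L s (conj s h hs ⇒ φ) →
    (M : Model) →
    ((t : Sort) (γ : Form L t) → Γ t γ → Valid M γ) →
    Valid M φ
mainTheorem11 𝕊 em L Γ s φ h hs hyps-in-Γ ⊢conj⇒φ M Γ-valid g w =
  ⇒-elim (soundness ⊢conj⇒φ M g w) (conj-holds M s h hs hyps-valid g w)
  where
    open Hybrid 𝕊
    open Soundness 𝕊 em
    hyps-valid : All (λ { (t , j , γ) → Valid M γ }) (h ∷ hs)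
    hyps-valid = All.map (λ {(t , j , γ)} → Γ-valid t γ) hyps-in-Γ
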